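{- Let $G$ be a one-point union of cycles of order $p$. Then $str(G)=p+2$.
   Context: A one-point union of cycles is a graph obtained from a collection of cycles by identifying one vertex from each cycle into a single common vertex (the cycles otherwise being disjoint). For a graph $G$ of order $p$, a numbering is a bijection $f:V(G)\to\{1,\dots,p\}$; $str_f(G)=\max\{f(u)+f(v): uv\in E(G)\}$ and $str(G)=\min\{str_f(G)\}$ over numberings. -}

module Defs where

open import Data.Nat using (ℕ; zero; suc; _+_; _∸_; _≤_)
open import Data.Fin using (Fin; toℕ)
open import Data.Unit using (⊤; tt)
open import Data.Sum using (_⊎_; inj₁; inj₂)
open import Data.Product using (Σ; ∃; _×_; _,_)
open import Data.Empty using (⊥)
open import Relation.Binary.PropositionalEquality using (_≡_)
open import Function.Definitions using (Bijective)
open import Function.Bundles using (_⇔_; _↔_)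

record Graph : Set₁ where
  field
    V   : Set
    Adj : V → V → Set
open Graph public

HasOrder : Graph → ℕ → Set
HasOrder G p = V G ↔ Fin p

Iso : Graph → Graph → Set
Iso G H = Σ (V G → V H) λ φ → Bijective _≡_ _≡_ φ ×
            (∀ u v → Adj G u v ⇔ Adj H (φ u) (φ v))

-- A numbering of G (of order p): a bijection f : V(G) → {1,…,p},
-- represented as a bijection V(G) → Fin p with label  suc (toℕ (f v)).
label : {A : Set} {p : ℕ} → (A → Fin p) → A → ℕ
label f v = suc (toℕ (f v))

IsNumbering : (G : Graph) (p : ℕ) → (V G → Fin p) → Set
IsNumbering G p f = Bijective _≡_ _≡_ f

StrfAtMost : (G : Graph) (p : ℕ) → (V G → Fin p) → ℕ → Set
StrfAtMost G p f s = ∀ u v → Adj G u v → label f u + label f v ≤ s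

StrfAtLeast : (G : Graph) (p : ℕ) → (V G → Fin p) → ℕ → Set
StrfAtLeast G p f s = ∃ λ u → ∃ λ v → Adj G u v × s ≤ label f u + label f v

-- str(G) = s, for G of order p:  min over numberings f of (max over edges of f(u)+f(v)) equals s,
-- i.e. some numbering attains str_f(G) ≤ s, and every numbering has str_f(G) ≥ s.
StrengthIs : (G : Graph) (p : ℕ) → ℕ → Set
StrengthIs G p s =
  (∃ λ (f : V G → Fin p) → IsNumbering G p f × StrfAtMost G p f s) ×
  (∀ (f : V G → Fin p) → IsNumbering G p f → StrfAtLeast G p f s)

-- Vertices: the common vertex (inj₁ tt), and for cycle i the remaining
-- ℓ i - 1 vertices (i , j), j = 0 … ℓ i - 2, forming the path
-- (i,0) - (i,1) - … - (i, ℓ i - 2), whose two ends are joined to the common vertex.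

OPUVertex : (k : ℕ) → (Fin k → ℕ) → Set
OPUVertex k ℓ = ⊤ ⊎ Σ (Fin k) (λ i → Fin (ℓ i ∸ 1))

CenterAdj : (k : ℕ) (ℓ : Fin k → ℕ) → Σ (Fin k) (λ i → Fin (ℓ i ∸ 1)) → Set
CenterAdj k ℓ (i , j) = (toℕ j ≡ 0) ⊎ (toℕ j ≡ ℓ i ∸ 2)

OPUAdj : (k : ℕ) (ℓ : Fin k → ℕ) → OPUVertex k ℓ → OPUVertex k ℓ → Set
OPUAdj k ℓ (inj₁ _) (inj₁ _) = ⊥
OPUAdj k ℓ (inj₁ _) (inj₂ x) = CenterAdj k ℓ x
OPUAdj k ℓ (inj₂ x) (inj₁ _) = CenterAdj k ℓ x
OPUAdj k ℓ (inj₂ (i , j)) (inj₂ (i' , j')) =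
  Σ (i ≡ i') λ _ → (toℕ j' ≡ suc (toℕ j)) ⊎ (toℕ j ≡ suc (toℕ j'))

OnePointUnion : (k : ℕ) → (Fin k → ℕ) → Graph
OnePointUnion k ℓ = record { V = OPUVertex k ℓ ; Adj = OPUAdj k ℓ }

IsOnePointUnionOfCycles : Graph → Set
IsOnePointUnionOfCycles G =
  ∃ λ (k : ℕ) → ∃ λ (ℓ : Fin k → ℕ) →
    1 ≤ k × (∀ i → 3 ≤ ℓ i) × Iso G (OnePointUnion k ℓ)

{-# OPTIONS --safe #-}
module Submission where

-- Give the common vertex label 1.  Deleting it leaves paths; lay them end to end and label
-- this long path along the zigzag p, 2, p − 1, 3, …, whose consecutive terms sum to p + 1 or
-- p + 2, so every edge has label sum at most p + 2.  Conversely every vertex has two distinct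
-- neighbours; of the two neighbours of the vertex labelled p at most one is labelled 1, and
-- the edge to the other one has label sum at least p + 2.

open import Defs
open import Data.Nat using (ℕ; _+_)

open import Data.Nat.Properties
open import Algebra.Properties.CommutativeSemigroup +-commutativeSemigroup using (interchange)
open import Algebra.Properties.Monoid.Sum +-0-monoid using (sum)
open import Data.Empty using (⊥-elim)
import Data.Fin as Fin
open import Data.Fin
  using (Fin; zero; suc; toℕ; fromℕ; fromℕ<; inject₁; lower₁; opposite; _↑ˡ_; _↑ʳ_; splitAt)
open import Data.Fin.Permutation using (↔⇒≡)
import Data.Fin.Properties as Finₚ
open import Data.Fin.Properties
  using (toℕ-injective; toℕ<n; toℕ-fromℕ; toℕ-fromℕ<; toℕ-inject₁; inject₁-injective; fromℕ≢inject₁;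
         toℕ-lower₁; inject₁-lower₁; opposite-prop; opposite-involutive;
         toℕ-↑ˡ; toℕ-↑ʳ; splitAt-↑ˡ; splitAt-↑ʳ; splitAt⁻¹-↑ˡ; splitAt⁻¹-↑ʳ)
import Data.Nat as ℕ
open import Data.Nat.Base using (zero; suc; _∸_; _≤_; _<_; pred; z≤n; s≤s; s≤s⁻¹)
open import Data.Product using (∃; ∃₂; Σ; _×_; _,_; proj₁; proj₂)
open import Data.Sum using (_⊎_; inj₁; inj₂)
open import Data.Unit using (⊤; tt)
open import Data.Vec.Functional using (Vector; tail)
open import Function using (_∘_)
open import Function.Bundles using (_↔_; Inverse; Bijection; mk⤖; mk↔ₛ′; Equivalence)
open import Function.Consequences.Propositional using (strictlySurjective⇒surjective)
import Function.Construct.Composition as Compose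
open import Function.Definitions using (Bijective; Injective; StrictlySurjective)
open import Function.Properties.Bijection using (⤖⇒↔)
open import Function.Properties.Inverse using (↔-sym; ↔-trans; ↔⇒⤖)
open import Relation.Binary.PropositionalEquality
open import Relation.Nullary using (yes; no)

-- zigzag n lists n − 1, 0, n − 2, 1, …
zigzag : ∀ n → Fin n → Fin n
zigzag (suc n) zero    = fromℕ n
zigzag (suc n) (suc t) = inject₁ (opposite (zigzag n t))

toℕ-zigzag-suc : ∀ n (t : Fin n) → toℕ (zigzag (suc n) (suc t)) ≡ n ∸ suc (toℕ (zigzag n t))
toℕ-zigzag-suc n t = trans (toℕ-inject₁ (opposite (zigzag n t))) (opposite-prop (zigzag n t))

opposite-injective : ∀ {n} → Injective _≡_ _≡_ (opposite {n})
opposite-injective {x = a} {b} e =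
  trans (sym (opposite-involutive a)) (trans (cong opposite e) (opposite-involutive b))

zigzag-injective : ∀ n → Injective _≡_ _≡_ (zigzag n)
zigzag-injective (suc n) {zero}  {zero}  _ = refl
zigzag-injective (suc n) {zero}  {suc _} e = ⊥-elim (fromℕ≢inject₁ e)
zigzag-injective (suc n) {suc _} {zero}  e = ⊥-elim (fromℕ≢inject₁ (sym e))
zigzag-injective (suc n) {suc a} {suc b} e =
  cong suc (zigzag-injective n (opposite-injective (inject₁-injective e)))

zigzag-strictlySurjective : ∀ n → StrictlySurjective _≡_ (zigzag n)
zigzag-strictlySurjective (suc n) y with n ℕ.≟ toℕ y
... | yes n≡y = zero , toℕ-injective (trans (toℕ-fromℕ n) n≡y)
... | no n≢y with zigzag-strictlySurjective n (opposite (lower₁ y n≢y))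
...   | t , zt≡ = suc t , (begin
  inject₁ (opposite (zigzag n t))              ≡⟨ cong (inject₁ ∘ opposite) zt≡ ⟩
  inject₁ (opposite (opposite (lower₁ y n≢y))) ≡⟨ cong inject₁ (opposite-involutive _) ⟩
  inject₁ (lower₁ y n≢y)                       ≡⟨ inject₁-lower₁ y n≢y ⟩
  y                                            ∎)
  where open ≡-Reasoning

zigzag-bijective : ∀ n → Bijective _≡_ _≡_ (zigzag n)
zigzag-bijective n =
  zigzag-injective n , strictlySurjective⇒surjective (zigzag-strictlySurjective n)

complement-sum-bounds : ∀ {n x y} → x ≤ n → y ≤ n → x + y ≤ n → n ≤ suc (x + y) →
  n ≤ (n ∸ x) + (n ∸ y) × (n ∸ x) + (n ∸ y) ≤ suc n
complement-sum-bounds {n} {x} {y} x≤n y≤n x+y≤n n≤1+x+y = lower , upper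
  where
  open ≤-Reasoning
  total : (n ∸ x) + (n ∸ y) + (x + y) ≡ n + n
  total = trans (interchange (n ∸ x) (n ∸ y) x y) (cong₂ _+_ (m∸n+n≡m x≤n) (m∸n+n≡m y≤n))
  lower : n ≤ (n ∸ x) + (n ∸ y)
  lower = +-cancelʳ-≤ (x + y) n _ (begin
    n + (x + y)                   ≤⟨ +-monoʳ-≤ n x+y≤n ⟩
    n + n                         ≡⟨ total ⟨
    (n ∸ x) + (n ∸ y) + (x + y)   ∎)
  upper : (n ∸ x) + (n ∸ y) ≤ suc n
  upper = +-cancelʳ-≤ (x + y) _ (suc n) (begin
    (n ∸ x) + (n ∸ y) + (x + y)   ≡⟨ total ⟩
    n + n                         ≤⟨ +-monoʳ-≤ n n≤1+x+y ⟩
    n + suc (x + y)               ≡⟨ +-suc n (x + y) ⟩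
    suc n + (x + y)               ∎)

zigzag-adjacent-sum : ∀ n (a b : Fin n) → toℕ b ≡ suc (toℕ a) →
  n ≤ 2 + (toℕ (zigzag n a) + toℕ (zigzag n b)) × toℕ (zigzag n a) + toℕ (zigzag n b) < n
zigzag-adjacent-sum (suc n) zero    zero          ()
zigzag-adjacent-sum (suc n) (suc a) zero          ()
zigzag-adjacent-sum (suc n) zero    (suc (suc b)) ()
zigzag-adjacent-sum (suc (suc n)) zero (suc zero) refl
  rewrite toℕ-zigzag-suc (suc n) zero | toℕ-fromℕ n | n∸n≡0 n | +-identityʳ n = n≤1+n _ , ≤-refl
zigzag-adjacent-sum (suc (suc n)) (suc a) (suc b) e
  rewrite toℕ-zigzag-suc (suc n) a | toℕ-zigzag-suc (suc n) b
  with zigzag-adjacent-sum (suc n) a b (suc-injective e)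
... | n≤2+s , s<n =
  let lower , upper = complement-sum-bounds (s≤s⁻¹ (toℕ<n (zigzag (suc n) a)))
                        (s≤s⁻¹ (toℕ<n (zigzag (suc n) b))) (s≤s⁻¹ s<n) (s≤s⁻¹ n≤2+s)
  in s≤s (s≤s lower) , s≤s upper

flatten : ∀ {k} (m : Vector ℕ k) → Σ (Fin k) (Fin ∘ m) → Fin (sum m)
flatten {suc k} m (zero  , j) = j ↑ˡ sum (tail m)
flatten {suc k} m (suc i , j) = m zero ↑ʳ flatten (tail m) (i , j)

unflatten : ∀ {k} (m : Vector ℕ k) → Fin (sum m) → Σ (Fin k) (Fin ∘ m)
unflatten {suc k} m x with splitAt (m zero) x
... | inj₁ j = zero , j
... | inj₂ y = let i , j = unflatten (tail m) y in suc i , j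

flatten-unflatten : ∀ {k} (m : Vector ℕ k) x → flatten m (unflatten m x) ≡ x
flatten-unflatten {suc k} m x with splitAt (m zero) x in split≡
... | inj₁ j = splitAt⁻¹-↑ˡ split≡
... | inj₂ y = trans (cong (m zero ↑ʳ_) (flatten-unflatten (tail m) y)) (splitAt⁻¹-↑ʳ split≡)

unflatten-flatten : ∀ {k} (m : Vector ℕ k) x → unflatten m (flatten m x) ≡ x
unflatten-flatten {suc k} m (zero , j) rewrite splitAt-↑ˡ (m zero) j (sum (tail m)) = refl
unflatten-flatten {suc k} m (suc i , j)
  rewrite splitAt-↑ʳ (m zero) (sum (tail m)) (flatten (tail m) (i , j))
        | unflatten-flatten (tail m) (i , j) = refl

flatten-↔ : ∀ {k} (m : Vector ℕ k) → Σ (Fin k) (Fin ∘ m) ↔ Fin (sum m)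
flatten-↔ m = mk↔ₛ′ (flatten m) (unflatten m) (flatten-unflatten m) (unflatten-flatten m)

toℕ-flatten-suc : ∀ {k} (m : Vector ℕ k) i (j j′ : Fin (m i)) → toℕ j′ ≡ suc (toℕ j) →
  toℕ (flatten m (i , j′)) ≡ suc (toℕ (flatten m (i , j)))
toℕ-flatten-suc {suc k} m zero j j′ j′≡1+j = begin
  toℕ (j′ ↑ˡ sum (tail m))      ≡⟨ toℕ-↑ˡ j′ _ ⟩
  toℕ j′                        ≡⟨ j′≡1+j ⟩
  suc (toℕ j)                   ≡⟨ cong suc (toℕ-↑ˡ j _) ⟨
  suc (toℕ (j ↑ˡ sum (tail m))) ∎
  where open ≡-Reasoning
toℕ-flatten-suc {suc k} m (suc i) j j′ j′≡1+j = begin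
  toℕ (m zero ↑ʳ flatten (tail m) (i , j′))      ≡⟨ toℕ-↑ʳ (m zero) _ ⟩
  m zero + toℕ (flatten (tail m) (i , j′))       ≡⟨ cong (m zero +_) (toℕ-flatten-suc (tail m) i j j′ j′≡1+j) ⟩
  m zero + suc (toℕ (flatten (tail m) (i , j)))  ≡⟨ +-suc (m zero) _ ⟩
  suc (m zero + toℕ (flatten (tail m) (i , j)))  ≡⟨ cong suc (toℕ-↑ʳ (m zero) _) ⟨
  suc (toℕ (m zero ↑ʳ flatten (tail m) (i , j))) ∎
  where open ≡-Reasoning

extendByZero : ∀ {A : Set} {n} → (A → Fin n) → ⊤ ⊎ A → Fin (suc n)
extendByZero g (inj₁ _) = zero
extendByZero g (inj₂ a) = suc (g a)

extendByZero-bijective : ∀ {A : Set} {n} {g : A → Fin n} →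
  Bijective _≡_ _≡_ g → Bijective _≡_ _≡_ (extendByZero g)
extendByZero-bijective {g = g} (g-inj , g-surj) = injective , strictlySurjective⇒surjective surjective
  where
  injective : Injective _≡_ _≡_ (extendByZero g)
  injective {inj₁ _} {inj₁ _} _ = refl
  injective {inj₂ a} {inj₂ b} e = cong inj₂ (g-inj (Finₚ.suc-injective e))
  surjective : StrictlySurjective _≡_ (extendByZero g)
  surjective zero    = inj₁ tt , refl
  surjective (suc y) = inj₂ (proj₁ (g-surj y)) , cong suc (proj₂ (g-surj y) refl)

Iso⇒↔ : ∀ {G H} → Iso G H → V G ↔ V H
Iso⇒↔ (_ , φ-bij , _) = ⤖⇒↔ (mk⤖ φ-bij)

StrengthIs-resp-Iso : ∀ {G H p s} → Iso G H → StrengthIs H p s → StrengthIs G p s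
StrengthIs-resp-Iso {G} {H} {p} {s} G≅H@(φ , φ-bij , adj⇔) ((f , f-bij , f-bound) , lower) =
  (f ∘ φ , Compose.bijective _≡_ _≡_ _≡_ φ-bij f-bij ,
    λ u v uv → f-bound (φ u) (φ v) (Equivalence.to (adj⇔ u v) uv)) ,
  lowerG
  where
  G↔H : V G ↔ V H
  G↔H = Iso⇒↔ {G} {H} G≅H
  open Inverse G↔H using (from; strictlyInverseˡ)
  from-bijective : Bijective _≡_ _≡_ from
  from-bijective = Bijection.bijective (↔⇒⤖ (↔-sym G↔H))
  lowerG : ∀ g → IsNumbering G p g → StrfAtLeast G p g s
  lowerG g g-bij with lower (g ∘ from) (Compose.bijective _≡_ _≡_ _≡_ from-bijective g-bij)
  ... | u , v , uv , s≤ = from u , from v ,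
    Equivalence.from (adj⇔ (from u) (from v))
      (subst₂ (Adj H) (sym (strictlyInverseˡ u)) (sym (strictlyInverseˡ v)) uv) , s≤

TwoNeighbours : (G : Graph) → V G → Set
TwoNeighbours G u = ∃₂ λ v w → Adj G u v × Adj G u w × v ≢ w

2≤suc-toℕ : ∀ {n} (x : Fin (suc n)) → x ≢ zero → 2 ≤ suc (toℕ x)
2≤suc-toℕ zero    x≢0 = ⊥-elim (x≢0 refl)
2≤suc-toℕ (suc x) _   = s≤s (s≤s z≤n)

strfAtLeast-twoNeighbours : (G : Graph) (n : ℕ) (f : V G → Fin (suc n)) →
  IsNumbering G (suc n) f → (∀ u → TwoNeighbours G u) → StrfAtLeast G (suc n) f (suc n + 2)
strfAtLeast-twoNeighbours G n f (f-inj , f-surj) twoNeighbours = heavyEdge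
  where
  top : V G
  top = proj₁ (f-surj (fromℕ n))
  label-top : label f top ≡ suc n
  label-top = cong suc (trans (cong toℕ (proj₂ (f-surj (fromℕ n)) refl)) (toℕ-fromℕ n))
  edgeFromTop : ∀ {v} → Adj G top v → f v ≢ zero → StrfAtLeast G (suc n) f (suc n + 2)
  edgeFromTop {v} top-v fv≢0 =
    top , v , top-v , +-mono-≤ (≤-reflexive (sym label-top)) (2≤suc-toℕ (f v) fv≢0)
  heavyEdge : StrfAtLeast G (suc n) f (suc n + 2)
  heavyEdge with twoNeighbours top
  ... | v , w , top-v , top-w , v≢w with f v Fin.≟ zero
  ...   | no fv≢0  = edgeFromTop top-v fv≢0
  ...   | yes fv≡0 = edgeFromTop top-w λ fw≡0 → v≢w (f-inj (trans fv≡0 (sym fw≡0)))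

centre-edge-bound : ∀ {n t} → t < n → 1 + (2 + t) ≤ suc n + 2
centre-edge-bound {n} t<n = ≤-trans (s≤s (s≤s (s≤s (<⇒≤ t<n)))) (≤-reflexive (+-comm 2 (suc n)))

path-edge-bound : ∀ {n a b} → a + b < n → (2 + a) + (2 + b) ≤ suc n + 2
path-edge-bound {n} {a} {b} a+b<n rewrite +-suc a (suc b) | +-suc a b | +-comm n 2 =
  s≤s (s≤s (s≤s a+b<n))

+-comm-≤ : ∀ a b {c} → a + b ≤ c → b + a ≤ c
+-comm-≤ a b {c} = subst (_≤ c) (+-comm a b)

suc≡∸1⇒≡∸2 : ∀ {a} m → suc a ≡ m ∸ 1 → a ≡ m ∸ 2
suc≡∸1⇒≡∸2 m e = trans (cong pred e) (pred[m∸n]≡m∸[1+n] m 1)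

first⊎predecessor : ∀ {m} (j : Fin m) → toℕ j ≡ 0 ⊎ ∃ λ (j⁻ : Fin m) → toℕ j ≡ suc (toℕ j⁻)
first⊎predecessor zero    = inj₁ refl
first⊎predecessor (suc j) = inj₂ (inject₁ j , cong suc (sym (toℕ-inject₁ j)))

last⊎successor : ∀ {m} (j : Fin m) → suc (toℕ j) ≡ m ⊎ ∃ λ (j⁺ : Fin m) → toℕ j⁺ ≡ suc (toℕ j)
last⊎successor {m} j with m ℕ.≟ suc (toℕ j)
... | yes m≡1+j = inj₁ (sym m≡1+j)
... | no  m≢1+j = inj₂ (lower₁ (suc j) m≢1+j , toℕ-lower₁ (suc j) m≢1+j)

module _ {k : ℕ} (ℓ : Fin k → ℕ) where

  private
    H : Graph
    H = OnePointUnion k ℓ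

  pathOrders : Vector ℕ k
  pathOrders i = ℓ i ∸ 1

  zigzagNumbering : OPUVertex k ℓ → Fin (suc (sum pathOrders))
  zigzagNumbering = extendByZero (zigzag _ ∘ flatten pathOrders)

  zigzagNumbering-bijective : Bijective _≡_ _≡_ zigzagNumbering
  zigzagNumbering-bijective = extendByZero-bijective
    (Compose.bijective _≡_ _≡_ _≡_ (Bijection.bijective (↔⇒⤖ (flatten-↔ pathOrders)))
                                   (zigzag-bijective _))

  onePointUnion↔Fin : OPUVertex k ℓ ↔ Fin (suc (sum pathOrders))
  onePointUnion↔Fin = ⤖⇒↔ (mk⤖ zigzagNumbering-bijective)

  zigzagNumbering-consecutive : ∀ i (j j′ : Fin (ℓ i ∸ 1)) → toℕ j′ ≡ suc (toℕ j) →
    label zigzagNumbering (inj₂ (i , j)) + label zigzagNumbering (inj₂ (i , j′))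
      ≤ suc (sum pathOrders) + 2
  zigzagNumbering-consecutive i j j′ j′≡1+j = path-edge-bound
    (proj₂ (zigzag-adjacent-sum _ _ _ (toℕ-flatten-suc pathOrders i j j′ j′≡1+j)))

  zigzagNumbering-strfAtMost :
    StrfAtMost H (suc (sum pathOrders)) zigzagNumbering (suc (sum pathOrders) + 2)
  zigzagNumbering-strfAtMost (inj₁ _) (inj₂ _) _ = centre-edge-bound (toℕ<n _)
  zigzagNumbering-strfAtMost (inj₂ _) (inj₁ _) _ = +-comm-≤ 1 _ (centre-edge-bound (toℕ<n _))
  zigzagNumbering-strfAtMost (inj₂ (i , j)) (inj₂ (_ , j′)) (refl , inj₁ j′≡1+j) =
    zigzagNumbering-consecutive i j j′ j′≡1+j
  zigzagNumbering-strfAtMost (inj₂ (i , j)) (inj₂ (_ , j′)) (refl , inj₂ j≡1+j′) =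
    +-comm-≤ (label zigzagNumbering (inj₂ (i , j′))) (label zigzagNumbering (inj₂ (i , j)))
      (zigzagNumbering-consecutive i j′ j j≡1+j′)

  private
    toℕ-cycle-position : ∀ {i} {j j′ : Fin (ℓ i ∸ 1)} →
      _≡_ {A = OPUVertex k ℓ} (inj₂ (i , j)) (inj₂ (i , j′)) → toℕ j ≡ toℕ j′
    toℕ-cycle-position refl = refl

  module _ (ℓ≥3 : ∀ i → 3 ≤ ℓ i) where

    centre-twoNeighbours : 1 ≤ k → TwoNeighbours H (inj₁ tt)
    centre-twoNeighbours k≥1 =
      inj₂ (i , fromℕ< 0<ℓ∸1) , inj₂ (i , fromℕ< ℓ∸2<ℓ∸1) ,
      inj₁ (toℕ-fromℕ< 0<ℓ∸1) , inj₂ (toℕ-fromℕ< ℓ∸2<ℓ∸1) , ends-differ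
      where
      i : Fin k
      i = fromℕ< k≥1
      0<ℓ∸1 : 0 < ℓ i ∸ 1
      0<ℓ∸1 = m<n⇒0<n∸m (≤-trans (n≤1+n 2) (ℓ≥3 i))
      ℓ∸2<ℓ∸1 : ℓ i ∸ 2 < ℓ i ∸ 1
      ℓ∸2<ℓ∸1 = ∸-monoʳ-< (n<1+n 1) (<⇒≤ (ℓ≥3 i))
      ends-differ : inj₂ (i , fromℕ< 0<ℓ∸1) ≢ inj₂ (i , fromℕ< ℓ∸2<ℓ∸1)
      ends-differ e = m>n⇒m∸n≢0 (ℓ≥3 i) (begin
        ℓ i ∸ 2                   ≡⟨ toℕ-fromℕ< ℓ∸2<ℓ∸1 ⟨
        toℕ (fromℕ< ℓ∸2<ℓ∸1)      ≡⟨ toℕ-cycle-position e ⟨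
        toℕ (fromℕ< 0<ℓ∸1)        ≡⟨ toℕ-fromℕ< 0<ℓ∸1 ⟩
        0                         ∎)
        where open ≡-Reasoning

    pathVertex-twoNeighbours : ∀ i (j : Fin (ℓ i ∸ 1)) → TwoNeighbours H (inj₂ (i , j))
    pathVertex-twoNeighbours i j with first⊎predecessor j | last⊎successor j
    ... | inj₁ j≡0 | inj₁ j-last =
      ⊥-elim (m>n⇒m∸n≢0 (ℓ≥3 i) (trans (sym (suc≡∸1⇒≡∸2 (ℓ i) j-last)) j≡0))
    ... | inj₁ j≡0 | inj₂ (j⁺ , j⁺≡1+j) =
      inj₁ tt , inj₂ (i , j⁺) , inj₁ j≡0 , (refl , inj₁ j⁺≡1+j) , λ ()
    ... | inj₂ (j⁻ , j≡1+j⁻) | inj₁ j-last =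
      inj₂ (i , j⁻) , inj₁ tt , (refl , inj₂ j≡1+j⁻) , inj₂ (suc≡∸1⇒≡∸2 (ℓ i) j-last) , λ ()
    ... | inj₂ (j⁻ , j≡1+j⁻) | inj₂ (j⁺ , j⁺≡1+j) =
      inj₂ (i , j⁻) , inj₂ (i , j⁺) , (refl , inj₂ j≡1+j⁻) , (refl , inj₁ j⁺≡1+j) ,
      λ e → <⇒≢ (m<n⇒m<1+n (n<1+n _))
                (trans (toℕ-cycle-position e) (trans j⁺≡1+j (cong suc j≡1+j⁻)))

    onePointUnion-twoNeighbours : 1 ≤ k → ∀ u → TwoNeighbours H u
    onePointUnion-twoNeighbours k≥1 (inj₁ tt)      = centre-twoNeighbours k≥1
    onePointUnion-twoNeighbours k≥1 (inj₂ (i , j)) = pathVertex-twoNeighbours i j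

    onePointUnion-strength : 1 ≤ k → StrengthIs H (suc (sum pathOrders)) (suc (sum pathOrders) + 2)
    onePointUnion-strength k≥1 =
      (zigzagNumbering , zigzagNumbering-bijective , zigzagNumbering-strfAtMost) ,
      λ f f-bij → strfAtLeast-twoNeighbours H _ f f-bij (onePointUnion-twoNeighbours k≥1)

mainTheorem13 : (G : Graph) (p : ℕ) → IsOnePointUnionOfCycles G → HasOrder G p →
    StrengthIs G p (p + 2)
mainTheorem13 G p (k , ℓ , k≥1 , ℓ≥3 , G≅H) G↔p =
  StrengthIs-resp-Iso G≅H
    (subst (λ q → StrengthIs H q (q + 2)) (sym p≡) (onePointUnion-strength ℓ ℓ≥3 k≥1))
  where
  H : Graph
  H = OnePointUnion k ℓ
  p≡ : p ≡ suc (sum (pathOrders ℓ))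
  p≡ = ↔⇒≡ (↔-trans (↔-sym G↔p) (↔-trans (Iso⇒↔ {G} {H} G≅H) (onePointUnion↔Fin ℓ)))
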